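{- Let $G$ be a finite simple graph with at least one isolated vertex such that $G \neq \widetilde G$, and let $T$ be a minimum twin cover of $G$. Then for $t \geq 1$, $(t+1)|T| + t - 1 \leq \det(\mu_t(G)) \leq \det(\widetilde G) + (t+1)|T| + t - 1$. Both bounds are sharp (each is attained with equality for some such graph $G$).
   Context: Two vertices $x,y$ are twins if they have the same open neighborhood; $\widetilde G$ is the quotient graph whose vertices are the twin-equivalence classes $[x]$, with $[x]$ adjacent to $[z]$ iff some $p\in[x]$ and $q\in[z]$ are adjacent in $G$. A minimum twin cover is a minimum size set of vertices containing at least one vertex of every pair of twin vertices. For a finite simple graph $G$ with $V(G)=\{v_1,\dots,v_n\}$ and $t\ge 1$, the generalized Mycielskian $\mu_t(G)$ has vertex set $\{u_i^s : 1\le i\le n,\ 0\le s\le t\}\cup\{w\}$, where $u_i^0=v_i$. For each edge $v_iv_j$ of $G$, $\mu_t(G)$ has the edge $u_i^0u_j^0$ and the edges $u_i^su_j^{s+1}$ and $u_j^su_i^{s+1}$ for $0\le s<t$; in addition $u_i^t w$ is an edge for every $i$. There are no other edges. A determining set is a vertex subset such that the only automorphism fixing each of its vertices is the identity; $\det(\cdot)$ is the minimum size of a determining set. -}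

module Defs where

open import Data.Nat using (ℕ; zero; suc; _+_; _*_; _∸_; _≤_; _≡ᵇ_)
open import Data.Fin using (Fin; toℕ)
open import Data.Bool using (Bool; true; false; _∧_; _∨_)
open import Data.List using (List; length)
open import Data.List.Membership.Propositional using (_∈_)
open import Data.Product using (Σ; _×_; _,_; proj₁)
open import Data.Sum using (_⊎_)
open import Relation.Binary.PropositionalEquality using (_≡_; _≢_)
open import Function.Bundles using (_↔_; Inverse; _⇔_)

record Graph (V : Set) : Set where
  field
    adj : V → V → Bool
open Graph public

IsSimple : {V : Set} → Graph V → Set
IsSimple {V} G = (∀ (x y : V) → adj G x y ≡ adj G y x) × (∀ (x : V) → adj G x x ≡ false)

Twins : {V : Set} → Graph V → V → V → Set
Twins {V} G x y = ∀ (z : V) → adj G x z ≡ adj G y z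

HasIsolatedVertex : {V : Set} → Graph V → Set
HasIsolatedVertex {V} G = Σ V λ x → ∀ (y : V) → adj G x y ≡ false

-- G ≠ G̃ : some twin class is non-trivial, i.e. there are two distinct twins
HasDistinctTwins : {V : Set} → Graph V → Set
HasDistinctTwins {V} G = Σ V λ x → Σ V λ y → x ≢ y × Twins G x y

IsTwinCover : {V : Set} → Graph V → List V → Set
IsTwinCover {V} G T = ∀ (x y : V) → x ≢ y → Twins G x y → x ∈ T ⊎ y ∈ T

IsMinTwinCover : {V : Set} → Graph V → List V → Set
IsMinTwinCover {V} G T =
  IsTwinCover G T × (∀ (T' : List V) → IsTwinCover G T' → length T ≤ length T')

-- H on Fin m is the twin quotient of G via the class map q:
-- q is surjective, q x ≡ q y iff x,y twins, and [a] ~ [b] iff some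
-- representatives are adjacent in G.
IsTwinQuotient : {n m : ℕ} → Graph (Fin n) → Graph (Fin m) → (Fin n → Fin m) → Set
IsTwinQuotient {n} {m} G H q =
  (∀ (a : Fin m) → Σ (Fin n) λ x → q x ≡ a)
  × (∀ (x y : Fin n) → (q x ≡ q y) ⇔ Twins G x y)
  × (∀ (a b : Fin m) →
       (adj H a b ≡ true) ⇔ (Σ (Fin n) λ p → Σ (Fin n) λ p' → q p ≡ a × q p' ≡ b × adj G p p' ≡ true))

Automorphism : {V : Set} → Graph V → Set
Automorphism {V} G = Σ (V ↔ V) λ σ → ∀ (x y : V) → adj G (Inverse.to σ x) (Inverse.to σ y) ≡ adj G x y

IsDetermining : {V : Set} → Graph V → List V → Set
IsDetermining {V} G S =
  ∀ (σ : Automorphism G) →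
    (∀ (x : V) → x ∈ S → Inverse.to (proj₁ σ) x ≡ x) →
    ∀ (x : V) → Inverse.to (proj₁ σ) x ≡ x

IsDet : {V : Set} → Graph V → ℕ → Set
IsDet {V} G k =
  (Σ (List V) λ S → IsDetermining G S × length S ≡ k)
  × (∀ (S : List V) → IsDetermining G S → k ≤ length S)

-- generalized Mycielskian: vertex u i s is u_i^s (s = 0..t), and w
data MycVertex (n t : ℕ) : Set where
  u : Fin n → Fin (suc t) → MycVertex n t
  w : MycVertex n t

levelAdj : ℕ → ℕ → Bool
levelAdj s s' = ((s ≡ᵇ 0) ∧ (s' ≡ᵇ 0)) ∨ ((s' ≡ᵇ suc s) ∨ (s ≡ᵇ suc s'))

μ : {n : ℕ} → (t : ℕ) → Graph (Fin n) → Graph (MycVertex n t)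
adj (μ t G) (u i s) (u j s') = adj G i j ∧ levelAdj (toℕ s) (toℕ s')
adj (μ t G) (u i s) w = toℕ s ≡ᵇ t
adj (μ t G) w (u j s') = toℕ s' ≡ᵇ t
adj (μ t G) w w = false

Setting : (n : ℕ) → Graph (Fin n) → List (Fin n) → (m : ℕ) → Graph (Fin m) → (Fin n → Fin m) → Set
Setting n G T m H q =
  IsSimple G × HasIsolatedVertex G × HasDistinctTwins G × IsMinTwinCover G T × IsTwinQuotient G H q

{-# OPTIONS --safe #-}
module Submission where

-- Swapping two twins is an automorphism, so a determining set contains one vertex of every twin
-- pair. In μ_t(G) twins of G stay twins on every level, and the copies of the isolated vertices
-- on the levels 0, …, t − 1 have no neighbours at all, so they are pairwise twins. Hence a
-- determining set of μ_t(G) restricts to a twin cover of G on each of the t + 1 levels, and on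
-- all levels except the top one and at most one other it also contains the copy of a fixed
-- isolated vertex, which costs one vertex more than |T|: this gives (t + 1)|T| + t − 1.
-- Conversely, an automorphism fixes w (the only neighbour of the top copy of an isolated
-- vertex), preserves the distance to w and hence the level of every copy of a non-isolated
-- vertex, and therefore induces an automorphism of G̃ on level 0. So a determining set of G̃
-- lifted to level 0, together with T on every level and the middle levels of the (at most one)
-- isolated vertex outside T, is determining. Two isolated vertices attain both bounds.

open import Defs
open import Data.Nat using (ℕ; zero; suc; _+_; _*_; _∸_; _≤_; _<_; _≡ᵇ_; z≤n; s≤s; z<s; s≤s⁻¹; _<?_)
open import Data.Nat.Properties
open import Data.Nat.Tactic.RingSolver using (solve-∀)
open import Data.Fin using (Fin; zero; suc; toℕ; fromℕ; punchOut)
import Data.Fin as Fin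
open import Data.Fin.Induction using (<-weakInduction)
open import Data.Fin.Properties using (punchInᵢ≢i; punchIn-injective; punchIn-punchOut)
import Data.Fin.Properties as FinP
open import Data.Vec.Functional using (removeAt)
open import Algebra.Properties.CommutativeMonoid.Sum +-0-commutativeMonoid using (sum; sum-remove)
open import Data.Bool using (true; false; _∧_; _∨_)
open import Data.Bool.Properties
  using (T-≡; T-∧; T-∨; ∧-comm; ∨-comm; ∨-zeroʳ; ∧-identityʳ; ∧-conicalʳ; ¬-not)
  renaming (_≟_ to _≟ᵇ_)
open import Data.List using (List; []; _∷_; length; filter; map; _++_; allFin; cartesianProductWith)
open import Data.List.Properties using (filter-notAll; length-++; length-map; length-tabulate)
open import Data.List.Membership.Propositional.Properties
  using (∈-filter⁺; ∈-map⁺; ∈-++⁺ˡ; ∈-++⁺ʳ; ∈-allFin; ∈-cartesianProductWith⁺)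
open import Data.List.Relation.Unary.Any using (here; there)
import Data.List.Relation.Unary.Any as Any
open import Data.List.Membership.Propositional using (_∈_; _∉_)
open import Data.Product using (Σ; _×_; _,_; proj₁; proj₂)
open import Data.Sum using (_⊎_; inj₁; inj₂)
open import Data.Empty using (⊥-elim)
open import Relation.Nullary using (¬_; Dec; yes; no; ¬?; _×-dec_)
open import Relation.Binary.Definitions using (DecidableEquality)
open import Relation.Binary.PropositionalEquality
open import Function using (_∘_; id)
open import Function.Bundles using (Inverse; Equivalence; mk↔ₛ′; mk⇔)

sum-mono : ∀ {k} {f g : Fin k → ℕ} → (∀ s → f s ≤ g s) → sum f ≤ sum g
sum-mono {zero}  _   = z≤n
sum-mono {suc k} f≤g = +-mono-≤ (f≤g zero) (sum-mono (f≤g ∘ suc))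

sum-const : ∀ k a → sum {k} (λ _ → a) ≡ k * a
sum-const zero    a = refl
sum-const (suc k) a = cong (a +_) (sum-const k a)

*≤sum : ∀ {k a} {f : Fin k → ℕ} → (∀ s → a ≤ f s) → k * a ≤ sum f
*≤sum {k} {a} a≤f = subst (_≤ _) (sum-const k a) (sum-mono a≤f)

sum-≤-suc : ∀ {k} {f g : Fin (suc k) → ℕ} e → (∀ s → s ≢ e → f s ≤ g s) →
            f e ≤ suc (g e) → sum f ≤ suc (sum g)
sum-≤-suc {f = f} {g} e f≤g fe≤ = begin
  sum f                         ≡⟨ sum-remove f ⟩
  f e + sum (removeAt f e)      ≤⟨ +-mono-≤ fe≤ (sum-mono (λ j → f≤g _ (punchInᵢ≢i e j))) ⟩
  suc (g e + sum (removeAt g e)) ≡⟨ cong suc (sym (sum-remove g)) ⟩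
  suc (sum g)                   ∎
  where open ≤-Reasoning

sum-≥-except-two : ∀ {k a} {f : Fin k → ℕ} {e₁ e₂} → e₁ ≢ e₂ → (∀ s → a ≤ f s) →
                   (∀ s → s ≢ e₁ → s ≢ e₂ → suc a ≤ f s) → k * a + (k ∸ 2) ≤ sum f
sum-≥-except-two {suc zero} {e₁ = zero} {zero} e₁≢e₂ _ _ = ⊥-elim (e₁≢e₂ refl)
sum-≥-except-two {suc (suc k)} {a} {f} {e₁} {e₂} e₁≢e₂ a≤f a<f = begin
  (2 + k) * a + k               ≡⟨ regroup k a ⟩
  a + (a + k * suc a)           ≤⟨ +-mono-≤ (a≤f e₁) (+-mono-≤ (a≤f e₂) (*≤sum rest)) ⟩
  f e₁ + (f e₂ + remaining)     ≡⟨ cong (λ x → f e₁ + (f x + remaining)) (sym (punchIn-punchOut e₁≢e₂)) ⟩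
  f e₁ + (g e₂′ + remaining)    ≡⟨ cong (f e₁ +_) (sym (sum-remove g)) ⟩
  f e₁ + sum g                  ≡⟨ sym (sum-remove f) ⟩
  sum f                         ∎
  where
    open ≤-Reasoning
    regroup : ∀ k a → (2 + k) * a + k ≡ a + (a + k * suc a)
    regroup = solve-∀
    g : Fin (suc k) → ℕ
    g = removeAt f e₁
    e₂′ : Fin (suc k)
    e₂′ = punchOut e₁≢e₂
    remaining : ℕ
    remaining = sum (removeAt g e₂′)
    rest : ∀ j → suc a ≤ removeAt g e₂′ j
    rest j = a<f _ (punchInᵢ≢i e₁ _) λ eq →
      punchInᵢ≢i e₂′ j (punchIn-injective e₁ _ _ (trans eq (sym (punchIn-punchOut e₁≢e₂))))

length-cartesianProductWith : ∀ {A B C : Set} (f : A → B → C) xs ys →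
                              length (cartesianProductWith f xs ys) ≡ length xs * length ys
length-cartesianProductWith f []       ys = refl
length-cartesianProductWith f (x ∷ xs) ys = begin
  length (map (f x) ys ++ cartesianProductWith f xs ys)
    ≡⟨ length-++ (map (f x) ys) ⟩
  length (map (f x) ys) + length (cartesianProductWith f xs ys)
    ≡⟨ cong₂ _+_ (length-map (f x) ys) (length-cartesianProductWith f xs ys) ⟩
  length ys + length xs * length ys
    ∎
  where open ≡-Reasoning

Isolated : {V : Set} → Graph V → V → Set
Isolated {V} Γ v = ∀ (y : V) → adj Γ v y ≡ false

record OnlyNeighbour {V : Set} (Γ : Graph V) (v z : V) : Set where
  constructor onlyNeighbour
  field
    adjacent : adj Γ v z ≡ true
    unique   : ∀ y → adj Γ v y ≡ true → y ≡ z

record TwoNeighbours {V : Set} (Γ : Graph V) (v : V) : Set where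
  constructor twoNeighbours
  field
    {y₁ y₂}    : V
    distinct   : y₁ ≢ y₂
    adjacent₁  : adj Γ v y₁ ≡ true
    adjacent₂  : adj Γ v y₂ ≡ true

WithinDistance : {V : Set} → Graph V → V → ℕ → V → Set
WithinDistance     Γ c zero    v = v ≡ c
WithinDistance {V} Γ c (suc r) v = v ≡ c ⊎ Σ V λ y → adj Γ v y ≡ true × WithinDistance Γ c r y

module GraphProperties {V : Set} (Γ : Graph V) where

  apply : Automorphism Γ → V → V
  apply σ = Inverse.to (proj₁ σ)

  apply-adj : ∀ (σ : Automorphism Γ) x y → adj Γ (apply σ x) (apply σ y) ≡ adj Γ x y
  apply-adj = proj₂

  inverse : Automorphism Γ → Automorphism Γ
  inverse σ = mk↔ₛ′ from (apply σ) strictlyInverseʳ strictlyInverseˡ , from-adj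
    where
      open Inverse (proj₁ σ) using (from; strictlyInverseˡ; strictlyInverseʳ)
      from-adj : ∀ x y → adj Γ (from x) (from y) ≡ adj Γ x y
      from-adj x y = trans (sym (apply-adj σ (from x) (from y)))
                           (cong₂ (adj Γ) (strictlyInverseˡ x) (strictlyInverseˡ y))

  apply-inverse : ∀ σ y → apply σ (apply (inverse σ) y) ≡ y
  apply-inverse σ = Inverse.strictlyInverseˡ (proj₁ σ)

  inverse-apply : ∀ σ x → apply (inverse σ) (apply σ x) ≡ x
  inverse-apply σ = Inverse.strictlyInverseʳ (proj₁ σ)

  apply-injective : ∀ σ {x y} → apply σ x ≡ apply σ y → x ≡ y
  apply-injective σ {x} {y} eq =
    trans (sym (inverse-apply σ x)) (trans (cong (apply (inverse σ)) eq) (inverse-apply σ y))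

  adj-apply-inverse : ∀ σ x y → adj Γ (apply σ x) y ≡ adj Γ x (apply (inverse σ) y)
  adj-apply-inverse σ x y =
    trans (cong (adj Γ (apply σ x)) (sym (apply-inverse σ y))) (apply-adj σ x _)

  isolated-apply : ∀ σ {v} → Isolated Γ v → Isolated Γ (apply σ v)
  isolated-apply σ iso y = trans (adj-apply-inverse σ _ y) (iso _)

  onlyNeighbour-apply : ∀ σ {v z} → OnlyNeighbour Γ v z → OnlyNeighbour Γ (apply σ v) (apply σ z)
  onlyNeighbour-apply σ {v} {z} (onlyNeighbour vz only) =
    onlyNeighbour (trans (apply-adj σ v z) vz) λ y vy → trans (sym (apply-inverse σ y))
                   (cong (apply σ) (only _ (trans (sym (adj-apply-inverse σ v y)) vy)))

  twoNeighbours-apply : ∀ σ {v} → TwoNeighbours Γ v → TwoNeighbours Γ (apply σ v)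
  twoNeighbours-apply σ {v} (twoNeighbours {y₁} {y₂} y₁≢y₂ vy₁ vy₂) =
    twoNeighbours (y₁≢y₂ ∘ apply-injective σ) (trans (apply-adj σ v y₁) vy₁) (trans (apply-adj σ v y₂) vy₂)

  withinDistance-apply : ∀ σ {c} → apply σ c ≡ c → ∀ r {v} →
                         WithinDistance Γ c r v → WithinDistance Γ c r (apply σ v)
  withinDistance-apply σ σc≡c zero    refl = σc≡c
  withinDistance-apply σ σc≡c (suc r) (inj₁ refl) = inj₁ σc≡c
  withinDistance-apply σ σc≡c (suc r) (inj₂ (y , vy , near)) =
    inj₂ (apply σ y , trans (apply-adj σ _ y) vy , withinDistance-apply σ σc≡c r near)

  isolated-onlyNeighbour : ∀ {v z} → Isolated Γ v → ¬ OnlyNeighbour Γ v z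
  isolated-onlyNeighbour iso (onlyNeighbour vz _) with trans (sym (iso _)) vz
  ... | ()

  isolated-twoNeighbours : ∀ {v} → Isolated Γ v → ¬ TwoNeighbours Γ v
  isolated-twoNeighbours iso (twoNeighbours {y₁} _ vy₁ _) with trans (sym (iso y₁)) vy₁
  ... | ()

  onlyNeighbour-twoNeighbours : ∀ {v z} → OnlyNeighbour Γ v z → ¬ TwoNeighbours Γ v
  onlyNeighbour-twoNeighbours (onlyNeighbour _ only) (twoNeighbours {y₁} {y₂} y₁≢y₂ vy₁ vy₂) =
    y₁≢y₂ (trans (only y₁ vy₁) (sym (only y₂ vy₂)))

  isolated-twin : ∀ {a b} → Isolated Γ a → Twins Γ a b → Isolated Γ b
  isolated-twin iso tw z = trans (sym (tw z)) (iso z)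

  isolated-twins : ∀ {a b} → Isolated Γ a → Isolated Γ b → Twins Γ a b
  isolated-twins isoa isob z = trans (isoa z) (sym (isob z))

module TwinSwap {V : Set} (_≟_ : DecidableEquality V) (Γ : Graph V)
                (symmetric : ∀ a b → adj Γ a b ≡ adj Γ b a) where

  open import Data.List.Membership.DecPropositional _≟_ using (_∈?_)

  swap : V → V → V → V
  swap x y z with z ≟ x | z ≟ y
  ... | yes _ | _     = y
  ... | no _  | yes _ = x
  ... | no _  | no _  = z

  data SwapView (x y z : V) : V → Set where
    at-x  : z ≡ x → SwapView x y z y
    at-y  : z ≢ x → z ≡ y → SwapView x y z x
    other : z ≢ x → z ≢ y → SwapView x y z z

  swapView : ∀ x y z → SwapView x y z (swap x y z)
  swapView x y z with z ≟ x | z ≟ y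
  ... | yes z≡x | _     = at-x z≡x
  ... | no z≢x  | yes z≡y = at-y z≢x z≡y
  ... | no z≢x  | no z≢y  = other z≢x z≢y

  swap-other : ∀ {x y z} → z ≢ x → z ≢ y → swap x y z ≡ z
  swap-other {x} {y} {z} z≢x z≢y with swap x y z | swapView x y z
  ... | _ | at-x z≡x   = ⊥-elim (z≢x z≡x)
  ... | _ | at-y _ z≡y = ⊥-elim (z≢y z≡y)
  ... | _ | other _ _  = refl

  module _ {x y : V} (x≢y : x ≢ y) where

    swap-x : swap x y x ≡ y
    swap-x with swap x y x | swapView x y x
    ... | _ | at-x _      = refl
    ... | _ | at-y x≢x _  = ⊥-elim (x≢x refl)
    ... | _ | other x≢x _ = ⊥-elim (x≢x refl)

    swap-y : swap x y y ≡ x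
    swap-y with swap x y y | swapView x y y
    ... | _ | at-x y≡x    = ⊥-elim (x≢y (sym y≡x))
    ... | _ | at-y _ _    = refl
    ... | _ | other _ y≢y = ⊥-elim (y≢y refl)

    swap-involutive : ∀ z → swap x y (swap x y z) ≡ z
    swap-involutive z with swap x y z | swapView x y z
    ... | _ | at-x refl       = swap-y
    ... | _ | at-y _ refl     = swap-x
    ... | _ | other z≢x z≢y   = swap-other z≢x z≢y

    swap-adj : Twins Γ x y → ∀ a b → adj Γ (swap x y a) (swap x y b) ≡ adj Γ a b
    swap-adj tw a b = go a b
      where
        ax≡ay : ∀ a → adj Γ a x ≡ adj Γ a y
        ax≡ay a = trans (symmetric a x) (trans (tw a) (symmetric y a))
        xx≡yy : adj Γ x x ≡ adj Γ y y
        xx≡yy = trans (tw x) (ax≡ay y)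
        go : ∀ a b → adj Γ (swap x y a) (swap x y b) ≡ adj Γ a b
        go a b with swap x y a | swapView x y a | swap x y b | swapView x y b
        ... | _ | at-x refl   | _ | at-x refl   = sym xx≡yy
        ... | _ | at-x refl   | _ | at-y _ refl = symmetric y x
        ... | _ | at-x refl   | _ | other _ _   = sym (tw b)
        ... | _ | at-y _ refl | _ | at-x refl   = symmetric x y
        ... | _ | at-y _ refl | _ | at-y _ refl = xx≡yy
        ... | _ | at-y _ refl | _ | other _ _   = tw b
        ... | _ | other _ _   | _ | at-x refl   = sym (ax≡ay a)
        ... | _ | other _ _   | _ | at-y _ refl = ax≡ay a
        ... | _ | other _ _   | _ | other _ _   = refl

    twinSwap : Twins Γ x y → Automorphism Γ
    twinSwap tw = mk↔ₛ′ (swap x y) (swap x y) swap-involutive swap-involutive , swap-adj tw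

  determining-meets-twins : ∀ {S} → IsDetermining Γ S → ∀ {x y} → x ≢ y → Twins Γ x y → x ∈ S ⊎ y ∈ S
  determining-meets-twins {S} det {x} {y} x≢y tw with x ∈? S | y ∈? S
  ... | yes x∈S | _       = inj₁ x∈S
  ... | no _    | yes y∈S = inj₂ y∈S
  ... | no x∉S  | no y∉S  = ⊥-elim (x≢y (sym (trans (sym (swap-x x≢y)) (det (twinSwap x≢y tw) fixes x))))
    where
      fixes : ∀ z → z ∈ S → swap x y z ≡ z
      fixes z z∈S = swap-other (λ { refl → x∉S z∈S }) (λ { refl → y∉S z∈S })

module TwinQuotient {n m : ℕ} {G : Graph (Fin n)} {H : Graph (Fin m)} {q : Fin n → Fin m}
                    (symmetricG : ∀ i j → adj G i j ≡ adj G j i) (quotient : IsTwinQuotient G H q) where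

  rep : Fin m → Fin n
  rep a = proj₁ (proj₁ quotient a)

  q-rep : ∀ a → q (rep a) ≡ a
  q-rep a = proj₂ (proj₁ quotient a)

  q≡⇒twins : ∀ {i j} → q i ≡ q j → Twins G i j
  q≡⇒twins {i} {j} = Equivalence.to (proj₁ (proj₂ quotient) i j)

  twins⇒q≡ : ∀ {i j} → Twins G i j → q i ≡ q j
  twins⇒q≡ {i} {j} = Equivalence.from (proj₁ (proj₂ quotient) i j)

  rep-q : ∀ i → Twins G (rep (q i)) i
  rep-q i = q≡⇒twins (q-rep (q i))

  adj-twins : ∀ {i i′ j j′} → Twins G i i′ → Twins G j j′ → adj G i j ≡ adj G i′ j′
  adj-twins {i} {i′} {j} {j′} ii′ jj′ =
    trans (ii′ j) (trans (symmetricG i′ j) (trans (jj′ i′) (symmetricG j′ i′)))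

  adjH-rep : ∀ a b → adj H a b ≡ adj G (rep a) (rep b)
  adjH-rep a b with adj H a b in e | adj G (rep a) (rep b) in e′
  ... | false | false = refl
  ... | true  | true  = refl
  ... | true  | false with Equivalence.to (proj₂ (proj₂ quotient) a b) e
  ...   | p , p′ , qp , qp′ , pp′ = trans (sym (trans reps≡p,p′ pp′)) e′
    where
      reps≡p,p′ : adj G (rep a) (rep b) ≡ adj G p p′
      reps≡p,p′ = adj-twins (q≡⇒twins (trans (q-rep a) (sym qp))) (q≡⇒twins (trans (q-rep b) (sym qp′)))
  adjH-rep a b | false | true =
    trans (sym e) (Equivalence.from (proj₂ (proj₂ quotient) a b) (rep a , rep b , q-rep a , q-rep b , e′))

  AdjacencyPreserving : (Fin n → Fin n) → Set
  AdjacencyPreserving f = ∀ i j → adj G (f i) (f j) ≡ adj G i j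

  induced : (Fin n → Fin n) → Fin m → Fin m
  induced f a = q (f (rep a))

  module _ {f g : Fin n → Fin n} (f-adj : AdjacencyPreserving f) (fg-twins : ∀ i → Twins G (f (g i)) i) where

    twins-preserved : ∀ {i j} → Twins G i j → Twins G (f i) (f j)
    twins-preserved {i} {j} ij z = begin
      adj G (f i) z         ≡⟨ adj-twins {f i} (λ _ → refl) (λ y → sym (fg-twins z y)) ⟩
      adj G (f i) (f (g z)) ≡⟨ f-adj i (g z) ⟩
      adj G i (g z)         ≡⟨ ij (g z) ⟩
      adj G j (g z)         ≡⟨ sym (f-adj j (g z)) ⟩
      adj G (f j) (f (g z)) ≡⟨ adj-twins {f j} (λ _ → refl) (fg-twins z) ⟩
      adj G (f j) z         ∎
      where open ≡-Reasoning

    induced-q : ∀ i → induced f (q i) ≡ q (f i)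
    induced-q i = twins⇒q≡ (twins-preserved (rep-q i))

    induced-inverse : ∀ a → induced f (induced g a) ≡ a
    induced-inverse a = trans (induced-q (g (rep a))) (trans (twins⇒q≡ (fg-twins (rep a))) (q-rep a))

    induced-adj : ∀ a b → adj H (induced f a) (induced f b) ≡ adj H a b
    induced-adj a b = begin
      adj H (induced f a) (induced f b)                         ≡⟨ adjH-rep _ _ ⟩
      adj G (rep (induced f a)) (rep (induced f b))             ≡⟨ adj-twins (rep-q _) (rep-q _) ⟩
      adj G (f (rep a)) (f (rep b))                             ≡⟨ f-adj (rep a) (rep b) ⟩
      adj G (rep a) (rep b)                                     ≡⟨ sym (adjH-rep a b) ⟩
      adj H a b                                                 ∎
      where open ≡-Reasoning

  inducedAutomorphism : ∀ {f g} → AdjacencyPreserving f → AdjacencyPreserving g →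
                        (∀ i → Twins G (f (g i)) i) → (∀ i → Twins G (g (f i)) i) → Automorphism H
  inducedAutomorphism {f} {g} f-adj g-adj fg-twins gf-twins =
    mk↔ₛ′ (induced f) (induced g) (induced-inverse f-adj fg-twins) (induced-inverse g-adj gf-twins) ,
    induced-adj f-adj fg-twins

≡ᵇ-true : ∀ {m n} → m ≡ n → (m ≡ᵇ n) ≡ true
≡ᵇ-true {m} {n} m≡n = Equivalence.to T-≡ (≡⇒≡ᵇ m n m≡n)

≡ᵇ-true⁻¹ : ∀ {m n} → (m ≡ᵇ n) ≡ true → m ≡ n
≡ᵇ-true⁻¹ {m} {n} e = ≡ᵇ⇒≡ m n (Equivalence.from T-≡ e)

≡ᵇ-false : ∀ {m n} → m ≢ n → (m ≡ᵇ n) ≡ false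
≡ᵇ-false {m} {n} m≢n with m ≡ᵇ n in e
... | true  = ⊥-elim (m≢n (≡ᵇ-true⁻¹ e))
... | false = refl

levelAdj-suc : ∀ a → levelAdj a (suc a) ≡ true
levelAdj-suc a = trans (cong (λ b → ((a ≡ᵇ 0) ∧ false) ∨ (b ∨ (a ≡ᵇ suc (suc a)))) (≡ᵇ-true {a} refl))
                       (∨-zeroʳ ((a ≡ᵇ 0) ∧ false))

levelAdj-pred : ∀ a → levelAdj (suc a) a ≡ true
levelAdj-pred a = trans (cong (λ b → false ∨ ((a ≡ᵇ suc (suc a)) ∨ b)) (≡ᵇ-true {a} refl))
                        (∨-zeroʳ (a ≡ᵇ suc (suc a)))

levelAdj-sym : ∀ a b → levelAdj a b ≡ levelAdj b a
levelAdj-sym a b = cong₂ _∨_ (∧-comm (a ≡ᵇ 0) (b ≡ᵇ 0)) (∨-comm (b ≡ᵇ suc a) (a ≡ᵇ suc b))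

levelAdj⇒≤suc : ∀ a b → levelAdj a b ≡ true → b ≤ suc a
levelAdj⇒≤suc a b e with Equivalence.to (T-∨ {(a ≡ᵇ 0) ∧ (b ≡ᵇ 0)}) (Equivalence.from T-≡ e)
... | inj₁ both-zero = ≤-trans (≤-reflexive (≡ᵇ⇒≡ b 0 (proj₂ (Equivalence.to (T-∧ {a ≡ᵇ 0}) both-zero)))) z≤n
... | inj₂ up-or-down with Equivalence.to (T-∨ {b ≡ᵇ suc a}) up-or-down
...   | inj₁ up   = ≤-reflexive (≡ᵇ⇒≡ b (suc a) up)
...   | inj₂ down = ≤-trans (n≤1+n b) (≤-trans (≤-reflexive (sym (≡ᵇ⇒≡ a (suc b) down))) (n≤1+n a))

module Mycielskian {n : ℕ} (t : ℕ) (G : Graph (Fin n)) (symmetricG : ∀ i j → adj G i j ≡ adj G j i) where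

  V : Set
  V = MycVertex n t

  Γ : Graph V
  Γ = μ t G

  open GraphProperties Γ
  module G = GraphProperties G

  top : Fin (suc t)
  top = fromℕ t

  below-top : ∀ {s} → s ≢ top → toℕ s < t
  below-top {s} s≢top =
    ≤∧≢⇒< (s≤s⁻¹ (FinP.toℕ<n s)) (λ s≡t → s≢top (FinP.toℕ-injective (trans s≡t (sym (FinP.toℕ-fromℕ t)))))

  below-top⁻¹ : ∀ {s} → toℕ s < t → s ≢ top
  below-top⁻¹ s<t refl = <⇒≢ s<t (FinP.toℕ-fromℕ t)

  NonIsolated : Fin n → Set
  NonIsolated i = Σ (Fin n) λ j → adj G i j ≡ true

  isolatedʳ : ∀ {j} → Isolated G j → ∀ i → adj G i j ≡ false
  isolatedʳ {j} iso i = trans (symmetricG i j) (iso i)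

  isolated? : ∀ i → Dec (Isolated G i)
  isolated? i = FinP.all? (λ j → adj G i j ≟ᵇ false)

  isolated-or-nonIsolated : ∀ i → Isolated G i ⊎ NonIsolated i
  isolated-or-nonIsolated i with FinP.any? (λ j → adj G i j ≟ᵇ true)
  ... | yes nonIsolated = inj₂ nonIsolated
  ... | no ¬nonIsolated = inj₁ λ j → ¬-not (λ ij → ¬nonIsolated (j , ij))

  _≟V_ : DecidableEquality V
  u i s ≟V u j s′ with i FinP.≟ j | s FinP.≟ s′
  ... | yes refl | yes refl = yes refl
  ... | no i≢j   | _        = no λ { refl → i≢j refl }
  ... | yes _    | no s≢s′  = no λ { refl → s≢s′ refl }
  u _ _ ≟V w     = no λ ()
  w     ≟V u _ _ = no λ ()
  w     ≟V w     = yes refl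

  u-injectiveˡ : ∀ {i j : Fin n} {s s′ : Fin (suc t)} → u i s ≡ u j s′ → i ≡ j
  u-injectiveˡ refl = refl

  u-injectiveʳ : ∀ {i j : Fin n} {s s′ : Fin (suc t)} → u i s ≡ u j s′ → s ≡ s′
  u-injectiveʳ refl = refl

  μ-symmetric : ∀ a b → adj Γ a b ≡ adj Γ b a
  μ-symmetric (u i s) (u j s′) = cong₂ _∧_ (symmetricG i j) (levelAdj-sym (toℕ s) (toℕ s′))
  μ-symmetric (u _ _) w        = refl
  μ-symmetric w (u _ _)        = refl
  μ-symmetric w w              = refl

  twins-lift : ∀ {i j} s → Twins G i j → Twins Γ (u i s) (u j s)
  twins-lift s tw (u k s′) = cong (_∧ levelAdj (toℕ s) (toℕ s′)) (tw k)
  twins-lift s tw w        = refl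

  isolated-below-top : ∀ {i s} → Isolated G i → toℕ s < t → Isolated Γ (u i s)
  isolated-below-top iso s<t (u k _) rewrite iso k = refl
  isolated-below-top iso s<t w = ≡ᵇ-false (<⇒≢ s<t)

  atLevel : Fin (suc t) → List V → List (Fin n)
  atLevel s []           = []
  atLevel s (w ∷ S)      = atLevel s S
  atLevel s (u i s′ ∷ S) with s′ FinP.≟ s
  ... | yes _ = i ∷ atLevel s S
  ... | no _  = atLevel s S

  ∈-atLevel : ∀ {i s} S → u i s ∈ S → i ∈ atLevel s S
  ∈-atLevel (w ∷ S)      (there p) = ∈-atLevel S p
  ∈-atLevel {s = s} (u j s′ ∷ S) p with s′ FinP.≟ s | p
  ... | yes _    | here refl = here refl
  ... | yes _    | there p′  = there (∈-atLevel S p′)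
  ... | no s′≢s  | here refl = ⊥-elim (s′≢s refl)
  ... | no _     | there p′  = ∈-atLevel S p′

  sum-length-atLevel : ∀ S → sum (λ s → length (atLevel s S)) ≤ length S
  sum-length-atLevel []           = ≤-reflexive (trans (sum-const (suc t) 0) (*-zeroʳ (suc t)))
  sum-length-atLevel (w ∷ S)      = m≤n⇒m≤1+n (sum-length-atLevel S)
  sum-length-atLevel (u i s₀ ∷ S) =
    ≤-trans (sum-≤-suc s₀ other-levels same-level) (s≤s (sum-length-atLevel S))
    where
      other-levels : ∀ s → s ≢ s₀ → length (atLevel s (u i s₀ ∷ S)) ≤ length (atLevel s S)
      other-levels s s≢s₀ with s₀ FinP.≟ s
      ... | yes s₀≡s = ⊥-elim (s≢s₀ (sym s₀≡s))
      ... | no _     = ≤-refl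
      same-level : length (atLevel s₀ (u i s₀ ∷ S)) ≤ suc (length (atLevel s₀ S))
      same-level with s₀ FinP.≟ s₀
      ... | yes _ = ≤-refl
      ... | no _  = n≤1+n _

  module LowerBound (t≥1 : 1 ≤ t) {x₀ : Fin n} (isolated-x₀ : Isolated G x₀)
                    {T : List (Fin n)} (minimum : ∀ T′ → IsTwinCover G T′ → length T ≤ length T′)
                    {S : List V} (determining : IsDetermining Γ S) where

    open TwinSwap _≟V_ Γ μ-symmetric using (determining-meets-twins)
    open import Data.List.Membership.DecPropositional _≟V_ using (_∈?_)

    atLevel-twinCover : ∀ s → IsTwinCover G (atLevel s S)
    atLevel-twinCover s i j i≢j tw
      with determining-meets-twins determining (i≢j ∘ u-injectiveˡ) (twins-lift s tw)
    ... | inj₁ p = inj₁ (∈-atLevel S p)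
    ... | inj₂ p = inj₂ (∈-atLevel S p)

    Full : Fin (suc t) → Set
    Full s = ∀ j → Isolated G j → u j s ∈ S

    -- Every twin of x₀ is isolated, so dropping x₀ from a full level still leaves a twin cover.
    full-level-bonus : ∀ s → Full s → suc (length T) ≤ length (atLevel s S)
    full-level-bonus s full = begin
      suc (length T)                 ≤⟨ s≤s (minimum _ cover) ⟩
      suc (length (filter ≢x₀? L))   ≤⟨ filter-notAll ≢x₀? L (Any.map (λ x₀≡j x₀≢j → x₀≢j (sym x₀≡j)) x₀∈L) ⟩
      length L                       ∎
      where
        open ≤-Reasoning
        L = atLevel s S
        ≢x₀? : ∀ j → Dec (j ≢ x₀)
        ≢x₀? j = ¬? (j FinP.≟ x₀)
        x₀∈L : x₀ ∈ L
        x₀∈L = ∈-atLevel S (full x₀ isolated-x₀)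
        keep : ∀ {j} → j ∈ L → j ≢ x₀ → j ∈ filter ≢x₀? L
        keep = ∈-filter⁺ ≢x₀?
        cover : IsTwinCover G (filter ≢x₀? L)
        cover i j i≢j tw with i FinP.≟ x₀ | j FinP.≟ x₀
        ... | yes refl | yes refl = ⊥-elim (i≢j refl)
        ... | yes refl | no j≢x₀  = inj₂ (keep (∈-atLevel S (full j (G.isolated-twin isolated-x₀ tw))) j≢x₀)
        ... | no i≢x₀  | yes refl = inj₁ (keep (∈-atLevel S (full i (G.isolated-twin isolated-x₀ (sym ∘ tw)))) i≢x₀)
        ... | no i≢x₀ | no j≢x₀ with atLevel-twinCover s i j i≢j tw
        ...   | inj₁ p = inj₁ (keep p i≢x₀)
        ...   | inj₂ p = inj₂ (keep p j≢x₀)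

    -- The copies of isolated vertices below the top level are pairwise twins, so S misses at most one.
    pool-gap : Σ (Fin (suc t)) λ s* → s* ≢ top × (∀ s → s ≢ s* → s ≢ top → Full s)
    pool-gap with FinP.any? (λ s → FinP.any? (λ j → (toℕ s <? t) ×-dec isolated? j ×-dec ¬? (u j s ∈? S)))
    ... | yes (s* , j* , s*<t , isolated-j* , u-j*-s*∉S) = s* , below-top⁻¹ s*<t , full
      where
        full : ∀ s → s ≢ s* → s ≢ top → Full s
        full s s≢s* s≢top j isolated-j
          with determining-meets-twins determining (s≢s* ∘ u-injectiveʳ)
                 (isolated-twins {u j s} {u j* s*} (isolated-below-top isolated-j (below-top s≢top))
                                                   (isolated-below-top isolated-j* s*<t))
        ... | inj₁ p = p
        ... | inj₂ p = ⊥-elim (u-j*-s*∉S p)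
    ... | no no-gap = zero , below-top⁻¹ t≥1 , full
      where
        full : ∀ s → s ≢ zero → s ≢ top → Full s
        full s _ s≢top j isolated-j with u j s ∈? S
        ... | yes p = p
        ... | no p  = ⊥-elim (no-gap (s , j , below-top s≢top , isolated-j , p))

    lower-bound : suc t * length T + (t ∸ 1) ≤ length S
    lower-bound with pool-gap
    ... | s* , s*≢top , full =
      ≤-trans (sum-≥-except-two s*≢top (λ s → minimum _ (atLevel-twinCover s))
                                (λ s s≢s* s≢top → full-level-bonus s (full s s≢s* s≢top)))
              (sum-length-atLevel S)

  up : (s : Fin (suc t)) → toℕ s < t → Fin (suc t)
  up s s<t = Fin.fromℕ< (s≤s s<t)

  toℕ-up : ∀ s s<t → toℕ (up s s<t) ≡ suc (toℕ s)
  toℕ-up s s<t = FinP.toℕ-fromℕ< (s≤s s<t)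

  adj-up : ∀ {i k} s s<t → adj G i k ≡ true → adj Γ (u i s) (u k (up s s<t)) ≡ true
  adj-up s s<t ik = trans (cong₂ (λ a b → a ∧ levelAdj (toℕ s) b) ik (toℕ-up s s<t)) (levelAdj-suc (toℕ s))

  adj-down : ∀ i k (r : Fin t) → adj Γ (u i (suc r)) (u k (Fin.inject₁ r)) ≡ adj G i k
  adj-down i k r = trans (cong (λ b → adj G i k ∧ levelAdj (suc (toℕ r)) b) (FinP.toℕ-inject₁ r))
                         (trans (cong (adj G i k ∧_) (levelAdj-pred (toℕ r))) (∧-identityʳ _))

  adj-zero : ∀ i k → adj Γ (u i zero) (u k zero) ≡ adj G i k
  adj-zero i k = ∧-identityʳ _

  adj-w-top : ∀ i → adj Γ (u i top) w ≡ true
  adj-w-top i = ≡ᵇ-true (FinP.toℕ-fromℕ t)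

  onlyNeighbour-top : ∀ {i} → Isolated G i → OnlyNeighbour Γ (u i top) w
  onlyNeighbour-top {i} isolated-i = onlyNeighbour (adj-w-top i) only
    where
      only : ∀ y → adj Γ (u i top) y ≡ true → y ≡ w
      only (u k s) e with trans (sym (cong (_∧ levelAdj (toℕ top) (toℕ s)) (isolated-i k))) e
      ... | ()
      only w _ = refl

  twoNeighbours-w : ∀ {a₁ a₂} → a₁ ≢ a₂ → TwoNeighbours Γ w
  twoNeighbours-w {a₁} {a₂} a₁≢a₂ =
    twoNeighbours {y₁ = u a₁ top} {u a₂ top} (a₁≢a₂ ∘ u-injectiveˡ) (adj-w-top a₁) (adj-w-top a₂)

  twoNeighbours-inner : 1 ≤ t → ∀ {i} s → NonIsolated i → TwoNeighbours Γ (u i s)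
  twoNeighbours-inner t≥1 zero (k , ik) =
    twoNeighbours {y₁ = u k (up zero t≥1)} {u k zero}
                  (λ eq → 1+n≢0 (trans (sym (toℕ-up zero t≥1)) (cong toℕ (u-injectiveʳ eq))))
                  (adj-up zero t≥1 ik) (trans (adj-zero _ k) ik)
  twoNeighbours-inner t≥1 (suc r) (k , ik) with toℕ (suc r) <? t
  ... | yes s<t = twoNeighbours {y₁ = u k (up (suc r) s<t)} {u k (Fin.inject₁ r)}
                                apart (adj-up (suc r) s<t ik) (trans (adj-down _ k r) ik)
    where
      apart : u k (up (suc r) s<t) ≢ u k (Fin.inject₁ r)
      apart eq = <⇒≢ (m<n⇒m<1+n (n<1+n (toℕ r)))
        (trans (sym (FinP.toℕ-inject₁ r)) (trans (cong toℕ (sym (u-injectiveʳ eq))) (toℕ-up (suc r) s<t)))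
  ... | no s≮t = twoNeighbours {y₁ = w} {u k (Fin.inject₁ r)} (λ ()) (≡ᵇ-true s≡t) (trans (adj-down _ k r) ik)
    where
      s≡t : suc (toℕ r) ≡ t
      s≡t = ≤-antisym (s≤s⁻¹ (FinP.toℕ<n (suc r))) (≮⇒≥ s≮t)

  withinDistance-u : ∀ r {i s} → WithinDistance Γ w r (u i s) → t < r + toℕ s
  withinDistance-u (suc r) {i} {s} (inj₂ (w , e , _)) =
    s≤s (≤-trans (≤-reflexive (sym (≡ᵇ-true⁻¹ {toℕ s} e))) (m≤n+m (toℕ s) r))
  withinDistance-u (suc r) {i} {s} (inj₂ (u k s′ , e , near)) = begin-strict
    t                <⟨ withinDistance-u r near ⟩
    r + toℕ s′       ≤⟨ +-monoʳ-≤ r (levelAdj⇒≤suc (toℕ s) (toℕ s′) (∧-conicalʳ _ _ e)) ⟩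
    r + suc (toℕ s)  ≡⟨ +-suc r (toℕ s) ⟩
    suc r + toℕ s    ∎
    where open ≤-Reasoning

  withinDistance-inner : ∀ d {i s} → NonIsolated i → toℕ s + d ≡ t → WithinDistance Γ w (suc d) (u i s)
  withinDistance-inner zero    {i} {s} _ s+0≡t =
    inj₂ (w , ≡ᵇ-true (trans (sym (+-identityʳ (toℕ s))) s+0≡t) , refl)
  withinDistance-inner (suc d) {i} {s} (k , ik) s+d≡t =
    inj₂ (u k (up s s<t) , adj-up s s<t ik ,
          withinDistance-inner d (i , trans (symmetricG k i) ik)
                                 (trans (cong (_+ d) (toℕ-up s s<t)) (trans (sym (+-suc (toℕ s) d)) s+d≡t)))
    where
      s<t : toℕ s < t
      s<t = subst (toℕ s <_) s+d≡t (m<m+n (toℕ s) z<s)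

  data Kind : V → Set where
    apex  : Kind w
    pool  : ∀ {i s} → Isolated G i → toℕ s < t → Kind (u i s)
    leaf  : ∀ {i} → Isolated G i → Kind (u i top)
    inner : ∀ {i} s → NonIsolated i → Kind (u i s)

  kind : ∀ v → Kind v
  kind w = apex
  kind (u i s) with isolated-or-nonIsolated i
  ... | inj₂ nonIsolated-i = inner s nonIsolated-i
  ... | inj₁ isolated-i with s FinP.≟ top
  ...   | yes refl  = leaf isolated-i
  ...   | no s≢top  = pool isolated-i (below-top s≢top)

  module Automorphisms (t≥1 : 1 ≤ t) {a₁ a₂ : Fin n} (a₁≢a₂ : a₁ ≢ a₂)
                       {x₀ : Fin n} (isolated-x₀ : Isolated G x₀) where

    onlyNeighbour⇒leaf : ∀ {v z} → OnlyNeighbour Γ v z →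
                         z ≡ w × Σ (Fin n) λ i → Isolated G i × v ≡ u i top
    onlyNeighbour⇒leaf {v} only with kind v
    ... | apex           = ⊥-elim (onlyNeighbour-twoNeighbours only (twoNeighbours-w a₁≢a₂))
    ... | pool iso s<t   = ⊥-elim (isolated-onlyNeighbour (isolated-below-top iso s<t) only)
    ... | leaf {i} iso   = sym (OnlyNeighbour.unique only w (adj-w-top i)) , i , iso , refl
    ... | inner s nonIso = ⊥-elim (onlyNeighbour-twoNeighbours only (twoNeighbours-inner t≥1 s nonIso))

    isolated⇒pool : ∀ {v} → Isolated Γ v →
                    Σ (Fin n) λ i → Σ (Fin (suc t)) λ s → Isolated G i × toℕ s < t × v ≡ u i s
    isolated⇒pool {v} iso with kind v
    ... | apex                  = ⊥-elim (isolated-twoNeighbours iso (twoNeighbours-w a₁≢a₂))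
    ... | pool {i} {s} iso′ s<t = i , s , iso′ , s<t , refl
    ... | leaf iso′             = ⊥-elim (isolated-onlyNeighbour iso (onlyNeighbour-top iso′))
    ... | inner s nonIso        = ⊥-elim (isolated-twoNeighbours iso (twoNeighbours-inner t≥1 s nonIso))

    twoNeighbours⇒inner : ∀ {v} → v ≢ w → TwoNeighbours Γ v →
                          Σ (Fin n) λ i → Σ (Fin (suc t)) λ s → NonIsolated i × v ≡ u i s
    twoNeighbours⇒inner {v} v≢w two with kind v
    ... | apex                 = ⊥-elim (v≢w refl)
    ... | pool iso s<t         = ⊥-elim (isolated-twoNeighbours (isolated-below-top iso s<t) two)
    ... | leaf iso             = ⊥-elim (onlyNeighbour-twoNeighbours (onlyNeighbour-top iso) two)
    ... | inner {i} s nonIso   = i , s , nonIso , refl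

    apply-w : ∀ σ → apply σ w ≡ w
    apply-w σ = proj₁ (onlyNeighbour⇒leaf (onlyNeighbour-apply σ (onlyNeighbour-top isolated-x₀)))

    apply-≢w : ∀ σ {v} → v ≢ w → apply σ v ≢ w
    apply-≢w σ v≢w eq = v≢w (apply-injective σ (trans eq (sym (apply-w σ))))

    apply-leaf : ∀ σ {i} → Isolated G i → Σ (Fin n) λ i′ → Isolated G i′ × apply σ (u i top) ≡ u i′ top
    apply-leaf σ iso = proj₂ (onlyNeighbour⇒leaf (onlyNeighbour-apply σ (onlyNeighbour-top iso)))

    apply-pool : ∀ σ {i s} → Isolated G i → toℕ s < t →
                 Σ (Fin n) λ i′ → Σ (Fin (suc t)) λ s′ → Isolated G i′ × toℕ s′ < t × apply σ (u i s) ≡ u i′ s′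
    apply-pool σ iso s<t = isolated⇒pool (isolated-apply σ (isolated-below-top iso s<t))

    -- σ fixes w, so it preserves the distance to w, which is t + 1 − level on inner vertices.
    level-mono : ∀ σ {i i′ s s′} → NonIsolated i → apply σ (u i s) ≡ u i′ s′ → toℕ s ≤ toℕ s′
    level-mono σ {i} {i′} {s} {s′} nonIso eq = +-cancelʳ-≤ d (toℕ s) (toℕ s′) (begin
      toℕ s + d   ≡⟨ s+d≡t ⟩
      t           ≤⟨ s≤s⁻¹ (withinDistance-u (suc d) moved) ⟩
      d + toℕ s′  ≡⟨ +-comm d (toℕ s′) ⟩
      toℕ s′ + d  ∎)
      where
        open ≤-Reasoning
        d : ℕ
        d = t ∸ toℕ s
        s+d≡t : toℕ s + d ≡ t
        s+d≡t = m+[n∸m]≡n (s≤s⁻¹ (FinP.toℕ<n s))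
        moved : WithinDistance Γ w (suc d) (u i′ s′)
        moved = subst (WithinDistance Γ w (suc d)) eq
                      (withinDistance-apply σ (apply-w σ) (suc d) (withinDistance-inner d nonIso s+d≡t))

    apply-inner : ∀ σ {i} s → NonIsolated i → Σ (Fin n) λ i′ → NonIsolated i′ × apply σ (u i s) ≡ u i′ s
    apply-inner σ {i} s nonIso
      with twoNeighbours⇒inner (apply-≢w σ (λ ())) (twoNeighbours-apply σ (twoNeighbours-inner t≥1 s nonIso))
    ... | i′ , s′ , nonIso′ , eq = i′ , nonIso′ , trans eq (cong (u i′) (sym s≡s′))
      where
        back : apply (inverse σ) (u i′ s′) ≡ u i s
        back = trans (cong (apply (inverse σ)) (sym eq)) (inverse-apply σ _)
        s≡s′ : s ≡ s′
        s≡s′ = FinP.toℕ-injective (≤-antisym (level-mono σ nonIso eq) (level-mono (inverse σ) nonIso′ back))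

    index : V → Fin n
    index (u i _) = i
    index w       = x₀    -- junk: never reached, since automorphisms fix w

    levelZeroMap : Automorphism Γ → Fin n → Fin n
    levelZeroMap σ i = index (apply σ (u i zero))

    levelZeroMap-inner : ∀ σ {i} → NonIsolated i → apply σ (u i zero) ≡ u (levelZeroMap σ i) zero
    levelZeroMap-inner σ nonIso with apply-inner σ zero nonIso
    ... | _ , _ , eq = trans eq (cong (λ j → u (index j) zero) (sym eq))

    levelZeroMap-isolated : ∀ σ {i} → Isolated G i → Isolated G (levelZeroMap σ i)
    levelZeroMap-isolated σ iso with apply-pool σ iso t≥1
    ... | _ , _ , iso′ , _ , eq = subst (Isolated G) (cong index (sym eq)) iso′

    levelZeroMap-adj : ∀ σ i j → adj G (levelZeroMap σ i) (levelZeroMap σ j) ≡ adj G i j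
    levelZeroMap-adj σ i j with isolated-or-nonIsolated i | isolated-or-nonIsolated j
    ... | inj₁ iso-i | _ = trans (levelZeroMap-isolated σ iso-i _) (sym (iso-i j))
    ... | inj₂ _ | inj₁ iso-j =
      trans (isolatedʳ (levelZeroMap-isolated σ iso-j) _) (sym (isolatedʳ iso-j i))
    ... | inj₂ nonIso-i | inj₂ nonIso-j = begin
      adj G (levelZeroMap σ i) (levelZeroMap σ j)
        ≡⟨ sym (adj-zero _ _) ⟩
      adj Γ (u (levelZeroMap σ i) zero) (u (levelZeroMap σ j) zero)
        ≡⟨ sym (cong₂ (adj Γ) (levelZeroMap-inner σ nonIso-i) (levelZeroMap-inner σ nonIso-j)) ⟩
      adj Γ (apply σ (u i zero)) (apply σ (u j zero))
        ≡⟨ apply-adj σ _ _ ⟩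
      adj Γ (u i zero) (u j zero)
        ≡⟨ adj-zero i j ⟩
      adj G i j
        ∎
      where open ≡-Reasoning

    levelZeroMap-inverse : ∀ σ i → Twins G (levelZeroMap σ (levelZeroMap (inverse σ) i)) i
    levelZeroMap-inverse σ i with isolated-or-nonIsolated i
    ... | inj₁ iso = G.isolated-twins (levelZeroMap-isolated σ (levelZeroMap-isolated (inverse σ) iso)) iso
    ... | inj₂ nonIso = λ z → cong (λ j → adj G j z) (cong index (begin
      apply σ (u (levelZeroMap (inverse σ) i) zero)
        ≡⟨ cong (apply σ) (sym (levelZeroMap-inner (inverse σ) nonIso)) ⟩
      apply σ (apply (inverse σ) (u i zero))
        ≡⟨ apply-inverse σ _ ⟩
      u i zero
        ∎))
      where open ≡-Reasoning

    module UpperBound {T : List (Fin n)} (cover : IsTwinCover G T)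
                      {m : ℕ} {H : Graph (Fin m)} {q : Fin n → Fin m} (quotient : IsTwinQuotient G H q)
                      {SH : List (Fin m)} (determiningH : IsDetermining H SH) where

      open TwinQuotient symmetricG quotient
      open import Data.List.Membership.DecPropositional (FinP._≟_ {n}) using () renaming (_∈?_ to _∈ᵢ?_)
      open import Data.List.Membership.DecPropositional _≟V_ using (_∈?_)

      spare : Σ (Fin n) λ c → ∀ {i} → Isolated G i → i ∉ T → i ≡ c
      spare with FinP.any? (λ i → isolated? i ×-dec ¬? (i ∈ᵢ? T))
      ... | no none = x₀ , λ iso i∉T → ⊥-elim (none (_ , iso , i∉T))
      ... | yes (c , iso-c , c∉T) = c , same
        where
          same : ∀ {i} → Isolated G i → i ∉ T → i ≡ c
          same {i} iso i∉T with i FinP.≟ c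
          ... | yes i≡c = i≡c
          ... | no i≢c with cover i c i≢c (G.isolated-twins iso iso-c)
          ...   | inj₁ i∈T = ⊥-elim (i∉T i∈T)
          ...   | inj₂ c∈T = ⊥-elim (c∉T c∈T)

      c : Fin n
      c = proj₁ spare

      middle : Fin (t ∸ 1) → Fin (suc t)
      middle r = suc (Fin.inject≤ r (m∸n≤m t 1))

      lifted copies chain S : List V
      lifted = map (λ a → u (rep a) zero) SH
      copies = cartesianProductWith (λ s j → u j s) (allFin (suc t)) T
      chain  = map (λ r → u c (middle r)) (allFin (t ∸ 1))
      S      = lifted ++ copies ++ chain

      length-S : length S ≡ length SH + (suc t * length T + (t ∸ 1))
      length-S = begin
        length (lifted ++ copies ++ chain)              ≡⟨ length-++ lifted ⟩
        length lifted + length (copies ++ chain)        ≡⟨ cong (length lifted +_) (length-++ copies) ⟩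
        length lifted + (length copies + length chain)  ≡⟨ cong₂ _+_ (length-map _ SH)
                                                                      (cong₂ _+_ length-copies length-chain) ⟩
        length SH + (suc t * length T + (t ∸ 1))        ∎
        where
          open ≡-Reasoning
          length-copies : length copies ≡ suc t * length T
          length-copies = trans (length-cartesianProductWith _ (allFin (suc t)) T)
                                (cong (_* length T) (length-tabulate {n = suc t} id))
          length-chain : length chain ≡ t ∸ 1
          length-chain = trans (length-map _ (allFin (t ∸ 1))) (length-tabulate {n = t ∸ 1} id)

      lifted∈S : ∀ {a} → a ∈ SH → u (rep a) zero ∈ S
      lifted∈S a∈SH = ∈-++⁺ˡ (∈-map⁺ (λ a → u (rep a) zero) a∈SH)

      cover∈S : ∀ {j} s → j ∈ T → u j s ∈ S
      cover∈S s j∈T = ∈-++⁺ʳ lifted (∈-++⁺ˡ (∈-cartesianProductWith⁺ (λ s j → u j s) (∈-allFin s) j∈T))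

      middle∈S : ∀ r → toℕ (suc r) < t → u c (suc r) ∈ S
      middle∈S r sr<t = ∈-++⁺ʳ lifted (∈-++⁺ʳ copies
        (subst (λ s → u c s ∈ chain) middle-r′≡suc-r (∈-map⁺ (λ r → u c (middle r)) (∈-allFin r′))))
        where
          r<t∸1 : toℕ r < t ∸ 1
          r<t∸1 = ∸-monoˡ-≤ 1 sr<t
          r′ : Fin (t ∸ 1)
          r′ = Fin.fromℕ< r<t∸1
          middle-r′≡suc-r : middle r′ ≡ suc r
          middle-r′≡suc-r = cong suc (FinP.toℕ-injective (trans (FinP.toℕ-inject≤ r′ _) (FinP.toℕ-fromℕ< r<t∸1)))

      Covered : V → V → Set
      Covered v v′ = v ≡ v′ ⊎ v ∈ S ⊎ v′ ∈ S

      twins-covered : ∀ {i j} s → Twins G i j → Covered (u i s) (u j s)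
      twins-covered {i} {j} s tw with i FinP.≟ j
      ... | yes refl = inj₁ refl
      ... | no i≢j with cover i j i≢j tw
      ...   | inj₁ i∈T = inj₂ (inj₁ (cover∈S s i∈T))
      ...   | inj₂ j∈T = inj₂ (inj₂ (cover∈S s j∈T))

      pool∉S : ∀ {i s} → Isolated G i → toℕ s < t → u i s ∉ S → u i s ≡ u c zero
      pool∉S {i} {zero}  iso s<t ∉S = cong (λ j → u j zero) (proj₂ spare iso (∉S ∘ cover∈S zero))
      pool∉S {i} {suc r} iso s<t ∉S =
        ⊥-elim (∉S (subst (λ j → u j (suc r) ∈ S) (sym (proj₂ spare iso (∉S ∘ cover∈S (suc r)))) (middle∈S r s<t)))

      pool-covered : ∀ {i i′ s s′} → Isolated G i → Isolated G i′ → toℕ s < t → toℕ s′ < t →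
                     Covered (u i s) (u i′ s′)
      pool-covered {i} {i′} {s} {s′} iso iso′ s<t s′<t with u i s ∈? S | u i′ s′ ∈? S
      ... | yes ∈S | _      = inj₂ (inj₁ ∈S)
      ... | no _   | yes ∈S = inj₂ (inj₂ ∈S)
      ... | no ∉S  | no ∉S′ = inj₁ (trans (pool∉S iso s<t ∉S) (sym (pool∉S iso′ s′<t ∉S′)))

      module _ (σ : Automorphism Γ) (fixes : ∀ x → x ∈ S → apply σ x ≡ x) where

        fixed-if-covered : ∀ {v v′} → apply σ v ≡ v′ → Covered v v′ → apply σ v ≡ v
        fixed-if-covered eq (inj₁ refl)        = eq
        fixed-if-covered eq (inj₂ (inj₁ v∈S))  = fixes _ v∈S
        fixed-if-covered eq (inj₂ (inj₂ v′∈S)) = trans eq (apply-injective σ (trans (fixes _ v′∈S) (sym eq)))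

        quotient-fixed : ∀ a → induced (levelZeroMap σ) a ≡ a
        quotient-fixed = determiningH τ τ-fixes
          where
            τ : Automorphism H
            τ = inducedAutomorphism (levelZeroMap-adj σ) (levelZeroMap-adj (inverse σ))
                                    (levelZeroMap-inverse σ) (levelZeroMap-inverse (inverse σ))
            τ-fixes : ∀ a → a ∈ SH → induced (levelZeroMap σ) a ≡ a
            τ-fixes a a∈SH = trans (cong (q ∘ index) (fixes _ (lifted∈S a∈SH))) (q-rep a)

        twin-at-level-zero : ∀ i → Twins G i (levelZeroMap σ i)
        twin-at-level-zero i = q≡⇒twins (sym (begin
          q (levelZeroMap σ i)              ≡⟨ sym (induced-q (levelZeroMap-adj σ) (levelZeroMap-inverse σ) i) ⟩
          induced (levelZeroMap σ) (q i)    ≡⟨ quotient-fixed (q i) ⟩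
          q i                               ∎))
          where open ≡-Reasoning

        fixed-inner : ∀ s {i} → NonIsolated i → apply σ (u i s) ≡ u i s
        fixed-inner = <-weakInduction (λ s → ∀ {i} → NonIsolated i → apply σ (u i s) ≡ u i s) base step
          where
            base : ∀ {i} → NonIsolated i → apply σ (u i zero) ≡ u i zero
            base {i} nonIso =
              fixed-if-covered (levelZeroMap-inner σ nonIso) (twins-covered zero (twin-at-level-zero i))
            step : ∀ r → (∀ {i} → NonIsolated i → apply σ (u i (Fin.inject₁ r)) ≡ u i (Fin.inject₁ r)) →
                   ∀ {i} → NonIsolated i → apply σ (u i (suc r)) ≡ u i (suc r)
            step r below {i} nonIso with apply-inner σ (suc r) nonIso
            ... | i′ , _ , eq = fixed-if-covered eq (twins-covered (suc r) twins)
              where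
                twins : Twins G i i′
                twins z with isolated-or-nonIsolated z
                ... | inj₁ iso-z = trans (isolatedʳ iso-z i) (sym (isolatedʳ iso-z i′))
                ... | inj₂ nonIso-z = begin
                  adj G i z
                    ≡⟨ sym (adj-down i z r) ⟩
                  adj Γ (u i (suc r)) (u z (Fin.inject₁ r))
                    ≡⟨ sym (apply-adj σ _ _) ⟩
                  adj Γ (apply σ (u i (suc r))) (apply σ (u z (Fin.inject₁ r)))
                    ≡⟨ cong₂ (adj Γ) eq (below nonIso-z) ⟩
                  adj Γ (u i′ (suc r)) (u z (Fin.inject₁ r))
                    ≡⟨ adj-down i′ z r ⟩
                  adj G i′ z
                    ∎
                  where open ≡-Reasoning

        fixed : ∀ v → apply σ v ≡ v
        fixed v with kind v
        ... | apex = apply-w σ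
        ... | inner s nonIso = fixed-inner s nonIso
        ... | leaf iso with apply-leaf σ iso
        ...   | _ , iso′ , eq = fixed-if-covered eq (twins-covered top (G.isolated-twins iso iso′))
        fixed v | pool iso s<t with apply-pool σ iso s<t
        ...   | _ , _ , iso′ , s′<t , eq = fixed-if-covered eq (pool-covered iso iso′ s<t s′<t)

      upper-bound : Σ (List V) λ S → IsDetermining Γ S × length S ≡ length SH + (suc t * length T + (t ∸ 1))
      upper-bound = S , fixed , length-S

  det-lower-bound : 1 ≤ t → ∀ {x₀} → Isolated G x₀ → ∀ {T} → (∀ T′ → IsTwinCover G T′ → length T ≤ length T′) →
                    ∀ {k} → IsDet Γ k → suc t * length T + (t ∸ 1) ≤ k
  det-lower-bound t≥1 isolated-x₀ {T} minimum ((S , determining , |S|≡k) , _) =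
    subst (_ ≤_) |S|≡k (LowerBound.lower-bound t≥1 isolated-x₀ {T} minimum determining)

  det-upper-bound : 1 ≤ t → ∀ {a₁ a₂} → a₁ ≢ a₂ → ∀ {x₀} → Isolated G x₀ → ∀ {T} → IsTwinCover G T →
                    ∀ {m} {H : Graph (Fin m)} {q} → IsTwinQuotient G H q →
                    ∀ {d k} → IsDet H d → IsDet Γ k → k ≤ d + (suc t * length T + (t ∸ 1))
  det-upper-bound t≥1 a₁≢a₂ isolated-x₀ cover quotient ((SH , determiningH , |SH|≡d) , _) (_ , minimal)
    with Automorphisms.UpperBound.upper-bound t≥1 a₁≢a₂ isolated-x₀ cover quotient determiningH
  ... | S , determining , |S|≡ =
    ≤-trans (minimal S determining) (≤-reflexive (trans |S|≡ (cong (_+ _) |SH|≡d)))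

det-μ-bounds : ∀ n (G : Graph (Fin n)) T m (H : Graph (Fin m)) q → Setting n G T m H q →
               ∀ t → 1 ≤ t → ∀ d k → IsDet H d → IsDet (μ t G) k →
               (suc t * length T + (t ∸ 1) ≤ k) × (k ≤ d + (suc t * length T + (t ∸ 1)))
det-μ-bounds n G T m H q ((symmetric , _) , (_ , isolated-x₀) , (_ , _ , a₁≢a₂ , _) , (cover , minimum) , quotient)
             t t≥1 d k det-H det-μ =
  det-lower-bound t≥1 isolated-x₀ {T} minimum det-μ ,
  det-upper-bound t≥1 a₁≢a₂ isolated-x₀ {T} cover quotient det-H det-μ
  where open Mycielskian t G symmetric

module TwoIsolatedVertices where

  G₀ : Graph (Fin 2)
  G₀ = record { adj = λ _ _ → false }

  T₀ : List (Fin 2)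
  T₀ = zero ∷ []

  H₀ : Graph (Fin 1)
  H₀ = record { adj = λ _ _ → false }

  q₀ : Fin 2 → Fin 1
  q₀ _ = zero

  fin1-unique : ∀ (a b : Fin 1) → a ≡ b
  fin1-unique zero zero = refl

  cover₀ : IsTwinCover G₀ T₀
  cover₀ zero             _                _   _ = inj₁ (here refl)
  cover₀ (suc zero)       zero             _   _ = inj₂ (here refl)
  cover₀ (suc zero)       (suc zero)       1≢1 _ = ⊥-elim (1≢1 refl)

  minimum₀ : ∀ T′ → IsTwinCover G₀ T′ → length T₀ ≤ length T′
  minimum₀ []      cover with cover zero (suc zero) (λ ()) (λ _ → refl)
  ... | inj₁ ()
  ... | inj₂ ()
  minimum₀ (_ ∷ _) _ = s≤s z≤n

  quotient₀ : IsTwinQuotient G₀ H₀ q₀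
  quotient₀ = (λ a → zero , fin1-unique zero a) , (λ _ _ → mk⇔ (λ _ _ → refl) (λ _ → refl)) ,
              (λ _ _ → mk⇔ (λ ()) (λ { (_ , _ , _ , _ , ()) }))

  setting₀ : Setting 2 G₀ T₀ 1 H₀ q₀
  setting₀ = ((λ _ _ → refl) , (λ _ → refl)) , (zero , λ _ → refl) ,
             (zero , suc zero , (λ ()) , (λ _ → refl)) , (cover₀ , minimum₀) , quotient₀

  det-H₀ : IsDet H₀ 0
  det-H₀ = ([] , (λ _ _ b → fin1-unique _ b) , refl) , (λ _ _ → z≤n)

  det-μ₀ : ∀ t → 1 ≤ t → IsDet (μ t G₀) (suc t * length T₀ + (t ∸ 1))
  det-μ₀ t t≥1 =
    Automorphisms.UpperBound.upper-bound t≥1 {zero} {suc zero} (λ ()) {zero} isolated {T₀} cover₀ quotient₀ {[]}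
                                         (λ _ _ b → fin1-unique _ b) ,
    λ S determining → LowerBound.lower-bound t≥1 {zero} isolated {T₀} minimum₀ {S} determining
    where
      open Mycielskian t G₀ (λ _ _ → refl)
      isolated : Isolated G₀ zero
      isolated _ = refl

corollary3p19 :
    (∀ (n : ℕ) (G : Graph (Fin n)) (T : List (Fin n)) (m : ℕ) (H : Graph (Fin m)) (q : Fin n → Fin m)
       → Setting n G T m H q
       → ∀ (t : ℕ) → 1 ≤ t → ∀ (d k : ℕ) → IsDet H d → IsDet (μ t G) k
       → (suc t * length T + (t ∸ 1) ≤ k) × (k ≤ d + (suc t * length T + (t ∸ 1))))
    × (∀ (t : ℕ) → 1 ≤ t →
         Σ ℕ λ n → Σ (Graph (Fin n)) λ G → Σ (List (Fin n)) λ T → Σ ℕ λ m → Σ (Graph (Fin m)) λ H →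
         Σ (Fin n → Fin m) λ q → Setting n G T m H q × Σ ℕ λ k → IsDet (μ t G) k
           × k ≡ suc t * length T + (t ∸ 1))
    × (∀ (t : ℕ) → 1 ≤ t →
         Σ ℕ λ n → Σ (Graph (Fin n)) λ G → Σ (List (Fin n)) λ T → Σ ℕ λ m → Σ (Graph (Fin m)) λ H →
         Σ (Fin n → Fin m) λ q → Setting n G T m H q × Σ ℕ λ d → Σ ℕ λ k → IsDet H d × IsDet (μ t G) k
           × k ≡ d + (suc t * length T + (t ∸ 1)))
corollary3p19 =
  det-μ-bounds ,
  (λ t t≥1 → 2 , G₀ , T₀ , 1 , H₀ , q₀ , setting₀ , _ , det-μ₀ t t≥1 , refl) ,
  (λ t t≥1 → 2 , G₀ , T₀ , 1 , H₀ , q₀ , setting₀ , 0 , _ , det-H₀ , det-μ₀ t t≥1 , refl)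
  where open TwoIsolatedVertices
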